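{- For every $\sigma\in\widetilde S_m$ that is a minimal-length right $S_{\mathbf w}$-coset representative, $\mathrm{Inv}(\sigma)=\mathrm{Inv}(f_{\mathbf w}\circ\sigma)$.
   Context: $m,r$ are positive integers and $\mathbf w=(w_1,\dots,w_r)\in\mathbb Z^r_{\ge0}$ with $\sum w_i=m$. $\widetilde S_m$ is the group of bijections $\sigma:\mathbb Z\to\mathbb Z$ with $\sigma(x+m)=\sigma(x)+m$ and $\sum_{i=1}^m\sigma(i)=m(m+1)/2$. $f_{\mathbf w}:\mathbb Z\to\mathbb Z$ is defined by $f_{\mathbf w}(x)=i$ for $w_1+\dots+w_{i-1}<x\le w_1+\dots+w_i$ ($1\le i\le r$) and $f_{\mathbf w}(x+m)=f_{\mathbf w}(x)+r$. $\sigma$ is a minimal-length right coset representative for $S_{\mathbf w}=S_{w_1}\times\dots\times S_{w_r}$ if $\sigma^{ -1}(w_1+\dots+w_{i-1}+1)<\dots<\sigma^{ -1}(w_1+\dots+w_i)$ for all $i$. For a function $g:\mathbb Z\to\mathbb Z$, $\mathrm{Inv}(g)=\{(i,j)\in\mathbb Z^2:i<j,\ g(j)<g(i)\}$. -}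

module Defs where

open import Data.Nat as ℕ using (ℕ; zero; suc; NonZero)
open import Data.Integer as ℤ using (ℤ; +_; _+_; _*_; _-_; _<_)
open import Data.Integer.DivMod using (_%ℕ_; _/ℕ_)
open import Data.List using (List; []; _∷_; length)
open import Data.Nat.ListAction using (sum)
open import Data.Product using (_×_; Σ; _,_)
open import Function using (_∘_)
open import Function.Bundles using (_↔_; _⇔_; module Inverse)
open import Data.Bool using (true; false)
open import Relation.Binary.PropositionalEquality using (_≡_)

-- Block index (1-based) of a position k ∈ {1,…,m} for the composition w:
-- blockIdx w k = i  iff  w₁+…+w_{i-1} < k ≤ w₁+…+w_i.
-- (Returns length w + 1 out of range; only used for 1 ≤ k ≤ sum w.)
blockIdx : List ℕ → ℕ → ℕ
blockIdx []       k = 1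
blockIdx (w ∷ ws) k with k ℕ.≤ᵇ w
... | true  = 1
... | false = suc (blockIdx ws (k ℕ.∸ w))

-- f_w : ℤ → ℤ,  f_w(x) = i for w₁+…+w_{i-1} < x ≤ w₁+…+w_i, and f_w(x+m) = f_w(x)+r.
-- Written as: x - 1 = q·m + k' with 0 ≤ k' < m, then f_w(x) = q·r + blockIdx w (k'+1).
fw : (w : List ℕ) → .{{NonZero (sum w)}} → ℤ → ℤ
fw w x = ((x - + 1) /ℕ sum w) * + length w + + blockIdx w (suc ((x - + 1) %ℕ sum w))

sumRange : (ℤ → ℤ) → ℕ → ℤ
sumRange σ zero    = + 0
sumRange σ (suc n) = sumRange σ n + σ (+ suc n)

record IsAffinePerm (m : ℕ) (σ : ℤ ↔ ℤ) : Set where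
  open Inverse σ
  field
    periodic : ∀ x → to (x + + m) ≡ to x + + m
    sumCond  : sumRange to m ≡ + ((m ℕ.* suc m) ℕ./ 2)

-- minimal-length right coset representative for S_w:
-- σ⁻¹(w₁+…+w_{i-1}+1) < … < σ⁻¹(w₁+…+w_i) for all i, i.e. σ⁻¹(a) < σ⁻¹(a+1)
-- whenever a, a+1 lie in the same block {w₁+…+w_{i-1}+1,…,w₁+…+w_i}.
partialSum : List ℕ → ℕ → ℕ
partialSum w       zero    = 0
partialSum []      (suc i) = 0
partialSum (x ∷ w) (suc i) = x ℕ.+ partialSum w i

IsMinCosetRep : (w : List ℕ) → (σ : ℤ ↔ ℤ) → Set
IsMinCosetRep w σ =
  ∀ (i a : ℕ) → i ℕ.< length w →
    partialSum w i ℕ.< a → suc a ℕ.≤ partialSum w (suc i) →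
    Inverse.from σ (+ a) < Inverse.from σ (+ suc a)

Inv : (ℤ → ℤ) → ℤ → ℤ → Set
Inv g i j = (i < j) × (g j < g i)

-- f_w is weakly increasing, so every inversion of f_w ∘ σ is one of σ. Conversely, let i < j with
-- σ j < σ i but f_w (σ j) = f_w (σ i). Then f_w is constant on [σ j, σ i], so each pair a, a + 1 in
-- that interval lies in one block of w shifted by a multiple of m; the coset condition together with
-- the m-periodicity of σ⁻¹ makes σ⁻¹ increase at each such step, whence j < i, a contradiction.
module Submission where

open import Defs
open import Data.Nat using (ℕ; NonZero)
open import Data.Nat.ListAction using (sum)
open import Data.Integer using (ℤ)
open import Data.List using (List)
open import Function using (_⇔_; _↔_; module Inverse)

open import Data.Bool using (true; false; T)
open import Data.Empty using (⊥-elim)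
open import Data.Integer as ℤ using (+_; -[1+_]; _+_; _*_; _-_; -_; +≤+; +<+; _≤_; _<_)
open import Data.Integer.DivMod using (_%ℕ_; _/ℕ_; n%ℕd<d; a≡a%ℕn+[a/ℕn]*n)
import Data.Integer.Properties as ℤP
open import Data.Integer.Tactic.RingSolver using (solve-∀)
open import Algebra.Properties.AbelianGroup ℤP.+-0-abelianGroup using () renaming (∙-cancelʳ to +-cancelʳ)
open import Data.List using ([]; _∷_; length)
open import Data.Nat as ℕ using (zero; suc; z≤n; s≤s)
import Data.Nat.Properties as ℕP
open import Data.Product using (∃; ∃₂; _×_; _,_; proj₁; proj₂)
open import Data.Sum using (inj₁; inj₂)
open import Data.Unit using (tt)
open import Function using (_∘_; mk⇔)
open import Relation.Binary using (tri<; tri≈; tri>)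
open import Relation.Binary.PropositionalEquality

SameBlock : List ℕ → ℕ → Set
SameBlock w a =
  ∃ λ i → i ℕ.< length w × partialSum w i ℕ.< a × suc a ℕ.≤ partialSum w (suc i)

≤ᵇ≡true⇒≤ : ∀ m n → (m ℕ.≤ᵇ n) ≡ true → m ℕ.≤ n
≤ᵇ≡true⇒≤ m n eq = ℕP.≤ᵇ⇒≤ m n (subst T (sym eq) tt)

≤ᵇ≡false⇒> : ∀ m n → (m ℕ.≤ᵇ n) ≡ false → n ℕ.< m
≤ᵇ≡false⇒> m n eq = ℕP.≰⇒> (λ m≤n → subst T eq (ℕP.≤⇒≤ᵇ m≤n))

blockIdx-pos : ∀ w k → 0 ℕ.< blockIdx w k
blockIdx-pos []      k = s≤s z≤n
blockIdx-pos (x ∷ w) k with k ℕ.≤ᵇ x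
... | true  = s≤s z≤n
... | false = s≤s z≤n

blockIdx≤length : ∀ w k → 0 ℕ.< k → k ℕ.≤ sum w → blockIdx w k ℕ.≤ length w
blockIdx≤length []      (suc k) _   ()
blockIdx≤length (x ∷ w) k       0<k k≤sum with k ℕ.≤ᵇ x in eq
... | true  = s≤s z≤n
... | false = s≤s (blockIdx≤length w (k ℕ.∸ x) (ℕP.m<n⇒0<n∸m (≤ᵇ≡false⇒> k x eq))
                                   (ℕP.m≤n+o⇒m∸n≤o k x k≤sum))

suc-∸ : ∀ {x k} → x ℕ.≤ k → suc k ℕ.∸ x ≡ suc (k ℕ.∸ x)
suc-∸ = ℕP.+-∸-assoc 1

blockIdx-mono-suc : ∀ w k → blockIdx w k ℕ.≤ blockIdx w (suc k)
blockIdx-mono-suc []      k = ℕP.≤-refl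
blockIdx-mono-suc (x ∷ w) k with k ℕ.≤ᵇ x in eq₁ | suc k ℕ.≤ᵇ x in eq₂
... | true  | true  = ℕP.≤-refl
... | true  | false = s≤s z≤n
... | false | true  = ⊥-elim (ℕP.<-asym (≤ᵇ≡false⇒> k x eq₁) (≤ᵇ≡true⇒≤ (suc k) x eq₂))
... | false | false = s≤s (subst (λ k′ → blockIdx w (k ℕ.∸ x) ℕ.≤ blockIdx w k′)
                                (sym (suc-∸ (ℕP.<⇒≤ (≤ᵇ≡false⇒> k x eq₁))))
                                (blockIdx-mono-suc w (k ℕ.∸ x)))

SameBlock-shift : ∀ {x w k} → x ℕ.≤ k → SameBlock w (k ℕ.∸ x) → SameBlock (x ∷ w) k
SameBlock-shift {x} {w} {k} x≤k (i , i<len , lo , hi) =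
  suc i , s≤s i<len ,
  subst (x ℕ.+ partialSum w i ℕ.<_) (ℕP.m+[n∸m]≡n x≤k) (ℕP.+-monoʳ-< x lo) ,
  subst (ℕ._≤ x ℕ.+ partialSum w (suc i))
        (trans (ℕP.+-suc x (k ℕ.∸ x)) (cong suc (ℕP.m+[n∸m]≡n x≤k)))
        (ℕP.+-monoʳ-≤ x hi)

blockIdx-flat⇒SameBlock : ∀ w k → 0 ℕ.< k → suc k ℕ.≤ sum w →
  blockIdx w (suc k) ℕ.≤ blockIdx w k → SameBlock w k
blockIdx-flat⇒SameBlock []      k _   ()
blockIdx-flat⇒SameBlock (x ∷ w) k 0<k k<sum flat with k ℕ.≤ᵇ x in eq₁ | suc k ℕ.≤ᵇ x in eq₂
... | true  | true  = 0 , s≤s z≤n , 0<k , ℕP.≤-trans (≤ᵇ≡true⇒≤ (suc k) x eq₂) (ℕP.m≤m+n x 0)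
... | true  | false = ⊥-elim (ℕP.<⇒≱ (blockIdx-pos w (suc k ℕ.∸ x)) (ℕ.s≤s⁻¹ flat))
... | false | true  = ⊥-elim (ℕP.<-asym (≤ᵇ≡false⇒> k x eq₁) (≤ᵇ≡true⇒≤ (suc k) x eq₂))
... | false | false = SameBlock-shift x≤k
  (blockIdx-flat⇒SameBlock w (k ℕ.∸ x) (ℕP.m<n⇒0<n∸m (≤ᵇ≡false⇒> k x eq₁))
    (subst (ℕ._≤ sum w) (suc-∸ x≤k) (ℕP.m≤n+o⇒m∸n≤o (suc k) x k<sum))
    (subst (λ k′ → blockIdx w k′ ℕ.≤ blockIdx w (k ℕ.∸ x)) (suc-∸ x≤k) (ℕ.s≤s⁻¹ flat)))
  where
  x≤k : x ℕ.≤ k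
  x≤k = ℕP.<⇒≤ (≤ᵇ≡false⇒> k x eq₁)

≤⇒≡+ : ∀ {a b} → a ≤ b → ∃ λ n → b ≡ a + + n
≤⇒≡+ {a} {b} a≤b = ℤ.∣ b - a ∣ , (begin
  b                   ≡⟨ sym (i+[j-i]≡j a b) ⟩
  a + (b - a)         ≡⟨ cong (λ c → a + c) (sym (ℤP.0≤i⇒+∣i∣≡i (ℤP.i≤j⇒0≤j-i a≤b))) ⟩
  a + + ℤ.∣ b - a ∣   ∎)
  where
  open ≡-Reasoning
  i+[j-i]≡j : ∀ i j → i + (j - i) ≡ j
  i+[j-i]≡j = solve-∀

<⇒≡+suc : ∀ {a b} → a < b → ∃ λ n → b ≡ a + + suc n
<⇒≡+suc {a} a<b with ≤⇒≡+ (ℤP.i<j⇒suc[i]≤j a<b)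
... | n , refl = n , 1+i+j≡i+[1+j] a (+ n)
  where
  1+i+j≡i+[1+j] : ∀ i j → + 1 + i + j ≡ i + (+ 1 + j)
  1+i+j≡i+[1+j] = solve-∀

<-by-quotient : ∀ {M k k′ q q′} → k ℕ.< M → q < q′ → + k + q * + M < + k′ + q′ * + M
<-by-quotient {M} {k} {k′} {q} {q′} k<M q<q′ = begin-strict
  + k + q * + M        <⟨ ℤP.+-monoˡ-< (q * + M) (+<+ k<M) ⟩
  + M + q * + M        ≡⟨ m+q*m≡[1+q]*m (+ M) q ⟩
  (+ 1 + q) * + M      ≤⟨ ℤP.*-monoʳ-≤-nonNeg (+ M) (ℤP.i<j⇒suc[i]≤j q<q′) ⟩
  q′ * + M             ≤⟨ ℤP.i≤j+i _ (+ k′) ⟩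
  + k′ + q′ * + M      ∎
  where
  open ℤP.≤-Reasoning
  m+q*m≡[1+q]*m : ∀ m q → m + q * m ≡ (+ 1 + q) * m
  m+q*m≡[1+q]*m = solve-∀

quotient-remainder-unique : ∀ {M k k′ q q′} → k ℕ.< M → k′ ℕ.< M →
  + k + q * + M ≡ + k′ + q′ * + M → q ≡ q′ × k ≡ k′
quotient-remainder-unique {M} {k} {k′} {q} {q′} k<M k′<M eq with ℤP.<-cmp q q′
... | tri< q<q′ _ _ = ⊥-elim (ℤP.<-irrefl eq (<-by-quotient k<M q<q′))
... | tri> _ _ q′<q = ⊥-elim (ℤP.<-irrefl (sym eq) (<-by-quotient k′<M q′<q))
... | tri≈ _ refl _ = refl , ℤP.+-injective (+-cancelʳ (q * + M) (+ k) (+ k′) eq)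

Periodic : ℤ → (ℤ → ℤ) → Set
Periodic p h = ∀ x → h (x + p) ≡ h x + p

Periodic-from : ∀ {p} (σ : ℤ ↔ ℤ) → Periodic p (Inverse.to σ) → Periodic p (Inverse.from σ)
Periodic-from {p} σ to-periodic y = begin
  from (y + p)            ≡⟨ cong (λ z → from (z + p)) (sym (strictlyInverseˡ y)) ⟩
  from (to (from y) + p)  ≡⟨ cong from (sym (to-periodic (from y))) ⟩
  from (to (from y + p))  ≡⟨ strictlyInverseʳ (from y + p) ⟩
  from y + p              ∎
  where
  open Inverse σ
  open ≡-Reasoning

Periodic-* : ∀ {p} h → Periodic p h → ∀ q x → h (x + q * p) ≡ h x + q * p
Periodic-* {p} h periodic (+ n) x = Periodic-*ℕ n x
  where
  x+[1+n]*p≡x+n*p+p : ∀ x n p → x + (+ 1 + n) * p ≡ x + n * p + p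
  x+[1+n]*p≡x+n*p+p = solve-∀
  Periodic-*ℕ : ∀ n x → h (x + + n * p) ≡ h x + + n * p
  Periodic-*ℕ zero    x = trans (cong h (ℤP.+-identityʳ x)) (sym (ℤP.+-identityʳ (h x)))
  Periodic-*ℕ (suc n) x = begin
    h (x + + suc n * p)      ≡⟨ cong h (x+[1+n]*p≡x+n*p+p x (+ n) p) ⟩
    h (x + + n * p + p)      ≡⟨ periodic (x + + n * p) ⟩
    h (x + + n * p) + p      ≡⟨ cong (_+ p) (Periodic-*ℕ n x) ⟩
    h x + + n * p + p        ≡⟨ sym (x+[1+n]*p≡x+n*p+p (h x) (+ n) p) ⟩
    h x + + suc n * p        ∎
    where open ≡-Reasoning
Periodic-* {p} h periodic -[1+ n ] x = begin
  h z                                ≡⟨ y≡y+q*p-q*p (h z) (+ suc n) p ⟩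
  h z + + suc n * p + -[1+ n ] * p   ≡⟨ cong (_+ -[1+ n ] * p) (sym (Periodic-* h periodic (+ suc n) z)) ⟩
  h (z + + suc n * p) + -[1+ n ] * p ≡⟨ cong (λ y → h y + -[1+ n ] * p) (x-q*p+q*p≡x x (+ suc n) p) ⟩
  h x + -[1+ n ] * p                 ∎
  where
  open ≡-Reasoning
  z = x + -[1+ n ] * p
  y≡y+q*p-q*p : ∀ y q p → y ≡ y + q * p + (- q) * p
  y≡y+q*p-q*p = solve-∀
  x-q*p+q*p≡x : ∀ x q p → x + (- q) * p + q * p ≡ x
  x-q*p+q*p≡x = solve-∀

module _ (f : ℤ → ℤ) (f-step : ∀ a → f a ≤ f (a + + 1)) where

  stepwise-monotone : ∀ {a b} → a ≤ b → f a ≤ f b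
  stepwise-monotone a≤b with ≤⇒≡+ a≤b
  ... | n , refl = monotone-+ n _
    where
    monotone-+ : ∀ n a → f a ≤ f (a + + n)
    monotone-+ zero    a = ℤP.≤-reflexive (cong f (sym (ℤP.+-identityʳ a)))
    monotone-+ (suc n) a = ℤP.≤-trans (f-step a)
      (ℤP.≤-trans (monotone-+ n (a + + 1)) (ℤP.≤-reflexive (cong f (ℤP.+-assoc a (+ 1) (+ n)))))

  stepwise-increasing-on-fibres : (g : ℤ → ℤ) → (∀ a → f (a + + 1) ≤ f a → g a < g (a + + 1)) →
    ∀ {a b} → a < b → f b ≤ f a → g a < g b
  stepwise-increasing-on-fibres g g-step a<b fb≤fa with <⇒≡+suc a<b
  ... | n , refl = increasing-+ n _ fb≤fa
    where
    increasing-+ : ∀ n a → f (a + + suc n) ≤ f a → g a < g (a + + suc n)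
    increasing-+ zero    a flat = g-step a flat
    increasing-+ (suc n) a flat =
      ℤP.<-trans (g-step a first-flat) (subst (λ b → g (a + + 1) < g b) shift (increasing-+ n (a + + 1) rest-flat))
      where
      shift : a + + 1 + + suc n ≡ a + + suc (suc n)
      shift = ℤP.+-assoc a (+ 1) (+ suc n)
      flat′ : f (a + + 1 + + suc n) ≤ f a
      flat′ = subst (_≤ f a) (cong f (sym shift)) flat
      first-flat : f (a + + 1) ≤ f a
      first-flat = ℤP.≤-trans (stepwise-monotone (ℤP.i≤i+j (a + + 1) (+ suc n))) flat′
      rest-flat : f (a + + 1 + + suc n) ≤ f (a + + 1)
      rest-flat = ℤP.≤-trans flat′ (f-step a)

Inv-∘-monotone : (σ : ℤ ↔ ℤ) (f : ℤ → ℤ) → (∀ {a b} → a ≤ b → f a ≤ f b) →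
  (∀ {a b} → a < b → f b ≤ f a → Inverse.from σ a < Inverse.from σ b) →
  ∀ i j → Inv (Inverse.to σ) i j ⇔ Inv (f ∘ Inverse.to σ) i j
Inv-∘-monotone σ f f-mono from-increasing i j = mk⇔ forward backward
  where
  open Inverse σ
  forward : Inv to i j → Inv (f ∘ to) i j
  forward (i<j , σj<σi) = i<j , ℤP.≰⇒> λ fσi≤fσj →
    ℤP.<-asym i<j (subst₂ _<_ (strictlyInverseʳ j) (strictlyInverseʳ i)
                                (from-increasing σj<σi fσi≤fσj))
  backward : Inv (f ∘ to) i j → Inv to i j
  backward (i<j , fσj<fσi) = i<j , ℤP.≰⇒> λ σi≤σj → ℤP.<⇒≱ fσj<fσi (f-mono σi≤σj)

module _ (w : List ℕ) .{{_ : NonZero (sum w)}} where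

  private
    M r : ℕ
    M = sum w
    r = length w

  fw-normal : ∀ {k} q → k ℕ.< M → fw w (+ suc k + q * + M) ≡ q * + r + + blockIdx w (suc k)
  fw-normal {k} q k<M =
    cong₂ (λ q k → q * + r + + blockIdx w (suc k)) (proj₁ unique) (proj₂ unique)
    where
    x = + suc k + q * + M
    1+k+y-1≡k+y : ∀ k y → + 1 + k + y - + 1 ≡ k + y
    1+k+y-1≡k+y = solve-∀
    unique : (x - + 1) /ℕ M ≡ q × (x - + 1) %ℕ M ≡ k
    unique = quotient-remainder-unique (n%ℕd<d (x - + 1) M) k<M
      (trans (sym (a≡a%ℕn+[a/ℕn]*n (x - + 1) M)) (1+k+y-1≡k+y (+ k) (q * + M)))

  normal-form : ∀ x → ∃₂ λ k q → k ℕ.< M × x ≡ + suc k + q * + M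
  normal-form x = k , q , n%ℕd<d (x - + 1) M , (begin
    x                      ≡⟨ x≡1+[x-1] x ⟩
    + 1 + (x - + 1)        ≡⟨ cong (λ y → + 1 + y) (a≡a%ℕn+[a/ℕn]*n (x - + 1) M) ⟩
    + 1 + (+ k + q * + M)  ≡⟨ sym (ℤP.+-assoc (+ 1) (+ k) (q * + M)) ⟩
    + suc k + q * + M      ∎)
    where
    open ≡-Reasoning
    k = (x - + 1) %ℕ M
    q = (x - + 1) /ℕ M
    x≡1+[x-1] : ∀ x → x ≡ + 1 + (x - + 1)
    x≡1+[x-1] = solve-∀

  fw-inner-step : ∀ {k} q → suc k ℕ.< M →
    fw w (+ suc k + q * + M + + 1) ≡ q * + r + + blockIdx w (suc (suc k))
  fw-inner-step {k} q 1+k<M =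
    trans (cong (fw w) (1+k+y+1≡1+[1+k]+y (+ k) (q * + M))) (fw-normal q 1+k<M)
    where
    1+k+y+1≡1+[1+k]+y : ∀ k y → + 1 + k + y + + 1 ≡ + 1 + (+ 1 + k) + y
    1+k+y+1≡1+[1+k]+y = solve-∀

  fw-last-step : ∀ {k} q → suc k ≡ M → fw w (+ suc k + q * + M) < fw w (+ suc k + q * + M + + 1)
  fw-last-step {k} q 1+k≡M = begin-strict
    fw w (+ suc k + q * + M)          ≡⟨ fw-normal q (subst (k ℕ.<_) 1+k≡M ℕP.≤-refl) ⟩
    q * + r + + blockIdx w (suc k)    ≤⟨ ℤP.+-monoʳ-≤ (q * + r)
                                           (+≤+ (blockIdx≤length w (suc k) (s≤s z≤n) (ℕP.≤-reflexive 1+k≡M))) ⟩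
    q * + r + + r                     ≡⟨ q*r+r≡[1+q]*r+0 q (+ r) ⟩
    (+ 1 + q) * + r + + 0             <⟨ ℤP.+-monoʳ-< ((+ 1 + q) * + r) (+<+ (blockIdx-pos w 1)) ⟩
    (+ 1 + q) * + r + + blockIdx w 1  ≡⟨ sym (fw-normal (+ 1 + q) (subst (0 ℕ.<_) 1+k≡M (s≤s z≤n))) ⟩
    fw w (+ 1 + (+ 1 + q) * + M)      ≡⟨ cong (fw w) (sym (x+1≡1+[1+q]*M)) ⟩
    fw w (+ suc k + q * + M + + 1)    ∎
    where
    open ℤP.≤-Reasoning
    q*r+r≡[1+q]*r+0 : ∀ q r → q * r + r ≡ (+ 1 + q) * r + + 0
    q*r+r≡[1+q]*r+0 = solve-∀
    m+q*m+1≡1+[1+q]*m : ∀ m q → m + q * m + + 1 ≡ + 1 + (+ 1 + q) * m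
    m+q*m+1≡1+[1+q]*m = solve-∀
    x+1≡1+[1+q]*M : + suc k + q * + M + + 1 ≡ + 1 + (+ 1 + q) * + M
    x+1≡1+[1+q]*M = trans (cong (λ m → + m + q * + M + + 1) 1+k≡M) (m+q*m+1≡1+[1+q]*m (+ M) q)

  fw-mono-step : ∀ x → fw w x ≤ fw w (x + + 1)
  fw-mono-step x with normal-form x
  ... | k , q , k<M , refl with ℕP.m≤n⇒m<n∨m≡n k<M
  ...   | inj₂ last  = ℤP.<⇒≤ (fw-last-step q last)
  ...   | inj₁ inner = begin
    fw w (+ suc k + q * + M)                ≡⟨ fw-normal q k<M ⟩
    q * + r + + blockIdx w (suc k)          ≤⟨ ℤP.+-monoʳ-≤ (q * + r) (+≤+ (blockIdx-mono-suc w (suc k))) ⟩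
    q * + r + + blockIdx w (suc (suc k))    ≡⟨ sym (fw-inner-step q inner) ⟩
    fw w (+ suc k + q * + M + + 1)          ∎
    where open ℤP.≤-Reasoning

  fw-flat-step⇒SameBlock : ∀ x → fw w (x + + 1) ≤ fw w x →
    ∃₂ λ a q → SameBlock w a × x ≡ + a + q * + M
  fw-flat-step⇒SameBlock x flat with normal-form x
  ... | k , q , k<M , refl with ℕP.m≤n⇒m<n∨m≡n k<M
  ...   | inj₂ last  = ⊥-elim (ℤP.<⇒≱ (fw-last-step q last) flat)
  ...   | inj₁ inner = suc k , q ,
    blockIdx-flat⇒SameBlock w (suc k) (s≤s z≤n) inner (ℕP.≮⇒≥ λ increases →
      ℤP.<⇒≱ (ℤP.+-monoʳ-< (q * + r) (+<+ increases))
        (subst₂ _≤_ (fw-inner-step q inner) (fw-normal q k<M) flat)) ,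
    refl

IsMinCosetRep⇒from-increasing-in-block : ∀ w (σ : ℤ ↔ ℤ) → IsMinCosetRep w σ →
  Periodic (+ sum w) (Inverse.from σ) → ∀ {a} q → SameBlock w a →
  Inverse.from σ (+ a + q * + sum w) < Inverse.from σ (+ a + q * + sum w + + 1)
IsMinCosetRep⇒from-increasing-in-block w σ minRep from-periodic {a} q (i , i<r , lo , hi) = begin-strict
  from (+ a + q * + M)          ≡⟨ Periodic-* {+ M} from from-periodic q (+ a) ⟩
  from (+ a) + q * + M          <⟨ ℤP.+-monoˡ-< (q * + M) (minRep i a i<r lo hi) ⟩
  from (+ suc a) + q * + M      ≡⟨ sym (Periodic-* {+ M} from from-periodic q (+ suc a)) ⟩
  from (+ suc a + q * + M)      ≡⟨ cong from (1+a+y≡a+y+1 (+ a) (q * + M)) ⟩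
  from (+ a + q * + M + + 1)    ∎
  where
  open Inverse σ
  open ℤP.≤-Reasoning
  M = sum w
  1+a+y≡a+y+1 : ∀ a y → + 1 + a + y ≡ a + y + + 1
  1+a+y≡a+y+1 = solve-∀

mainTheorem8 : (w : List ℕ) → .{{_ : NonZero (sum w)}} → (σ : ℤ ↔ ℤ) →
    IsAffinePerm (sum w) σ → IsMinCosetRep w σ →
    ∀ (i j : ℤ) → Inv (Inverse.to σ) i j ⇔ Inv (λ x → fw w (Inverse.to σ x)) i j
mainTheorem8 w σ affine minRep =
  Inv-∘-monotone σ (fw w) (stepwise-monotone (fw w) (fw-mono-step w))
    (stepwise-increasing-on-fibres (fw w) (fw-mono-step w) from from-step)
  where
  open Inverse σ
  from-step : ∀ a → fw w (a + + 1) ≤ fw w a → from a < from (a + + 1)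
  from-step a flat with fw-flat-step⇒SameBlock w a flat
  ... | _ , q , sameBlock , refl =
    IsMinCosetRep⇒from-increasing-in-block w σ minRep
      (Periodic-from σ (IsAffinePerm.periodic affine)) q sameBlock
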